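{- Let $\mathbf H$ be a connected etog with stem prefix $\bar x$ and let $\mathbb H$ be a linear graph with $\operatorname{rel}(\mathbb H) = \mathbf H$. Then $\#_{\bar x \mapsto \bar x}(\mathbf H, \mathbf H) = \#_{\bar x \mapsto \bar x}(\mathbf H, \mathbb H)$.
   Context: A tree order on a finite set is a partial order $\preccurlyeq$ such that for every $x$ the set $\{y : y \preccurlyeq x\}$ is totally ordered. A tree-ordered graph (tog) $\mathbf G = (G, \preccurlyeq_{\mathbf G})$ is a finite graph with a tree order on $V(G)$ such that every edge $uv$ has $u \preccurlyeq_{\mathbf G} v$ or $v \preccurlyeq_{\mathbf G} u$; if the order is total it is a linear graph. An ordered vertex set is a sequence $x_1 \prec x_2 \prec \dots \prec x_\ell$. The stem of $\mathbf G$ is the ordered vertex set $\bar x$ of maximal length that is totally ordered and satisfies $\max \bar x \preccurlyeq_{\mathbf G} u$ for all $u \in V(\mathbf G) \setminus \bar x$; a stem prefix is an initial segment of the stem. For a connected linear graph $\mathbb H$, its elimination tree $\operatorname{ET}(\mathbb H)$ has root $x = \min \mathbb H$ whose children are the roots of $\operatorname{ET}(\mathbb K_i)$ for the components $\mathbb K_i$ of $\mathbb H - x$; $\operatorname{rel}(\mathbb H) = (H, \preccurlyeq)$ with $u \preccurlyeq v$ iff $u$ is an ancestor of or equal to $v$ in $\operatorname{ET}(\mathbb H)$. An etog is a tog equal to $\operatorname{rel}(\mathbb H)$ for some connected linear graph $\mathbb H$. An embedding of tog $\mathbf H$ into tog $\mathbf G$ is an injective $\phi: V(H) \to V(G)$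 with $uv \in E(H) \iff \phi(u)\phi(v) \in E(G)$ and $u \preccurlyeq_{\mathbf H} v \implies \phi(u) \preccurlyeq_{\mathbf G} \phi(v)$. For a stem prefix $\bar x = (x_1,\dots,x_k)$ of $\mathbf H$ and ordered vertex set $\bar y = (y_1,\dots,y_k)$ of $\mathbf G$, $\#_{\bar x \mapsto \bar y}(\mathbf H, \mathbf G)$ is the number of embeddings $\phi$ of $\mathbf H$ into $\mathbf G$ with $\phi(x_i) = y_i$ for all $i$. -}

module Defs where

open import Level using (0ℓ)
open import Data.Nat using (ℕ; zero; suc; _≤_)
open import Data.Fin using (Fin; _≟_)
open import Data.Bool using (Bool; true; false; T; _∧_; _∨_; not)
open import Data.Bool.Properties using () renaming (_≟_ to _≟ᵇ_)
open import Data.List using (List; []; _∷_; _++_; _∷ʳ_; length; map; concatMap; allFin)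
open import Data.List.Membership.Propositional using (_∈_; _∉_)
open import Data.List.Relation.Unary.AllPairs using (AllPairs)
open import Data.Vec.Functional using (Vector)
open import Data.Product using (Σ; ∃; ∃-syntax; _×_; _,_)
open import Data.Sum using (_⊎_)
open import Data.Unit using (⊤)
open import Relation.Binary.PropositionalEquality using (_≡_; _≢_)
open import Relation.Nullary.Decidable using (⌊_⌋)

-- Graphs and tree orders on the vertex set Fin n.
-- Adjacency and order are Bool-valued (so everything is decidable/countable).

record IsGraph {n : ℕ} (adj : Fin n → Fin n → Bool) : Set where
  field
    sym     : ∀ u v → T (adj u v) → T (adj v u)
    irrefl  : ∀ u → T (not (adj u u))

record IsTreeOrder {n : ℕ} (le : Fin n → Fin n → Bool) : Set where
  field
    reflexive : ∀ x → T (le x x)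
    antisym   : ∀ x y → T (le x y) → T (le y x) → x ≡ y
    trans     : ∀ x y z → T (le x y) → T (le y z) → T (le x z)
    downTotal : ∀ x y z → T (le y x) → T (le z x) → T (le y z) ⊎ T (le z y)

record Tog (n : ℕ) : Set where
  field
    adj        : Fin n → Fin n → Bool
    le         : Fin n → Fin n → Bool
    isGraph    : IsGraph adj
    isTreeOrder : IsTreeOrder le
    edgeComparable : ∀ u v → T (adj u v) → T (le u v) ⊎ T (le v u)

open Tog public

IsLinear : ∀ {n} → Tog n → Set
IsLinear G = ∀ u v → T (le G u v) ⊎ T (le G v u)

Subset : ℕ → Set₁
Subset n = Fin n → Set

data PathIn {n : ℕ} (adj : Fin n → Fin n → Bool) (S : Subset n) : Fin n → Fin n → Set where
  stop : ∀ {a} → S a → PathIn adj S a a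
  step : ∀ {a b c} → S a → T (adj a b) → PathIn adj S b c → PathIn adj S a c

ConnectedIn : ∀ {n} → (Fin n → Fin n → Bool) → Subset n → Set
ConnectedIn adj S = ∀ a b → S a → S b → PathIn adj S a b

Connected : ∀ {n} → Tog n → Set
Connected G = ConnectedIn (adj G) (λ _ → ⊤)

IsComponent : ∀ {n} → (Fin n → Fin n → Bool) → Subset n → Subset n → Set
IsComponent adj S K =
  (∀ a → K a → S a) × (∃[ a ] K a) × ConnectedIn adj K
  × (∀ a b → K a → S b → T (adj a b) → K b)

IsMinIn : ∀ {n} → (Fin n → Fin n → Bool) → Subset n → Fin n → Set
IsMinIn le S x = S x × (∀ y → S y → T (le x y))

_∖_ : ∀ {n} → Subset n → Fin n → Subset n
(S ∖ x) y = S y × y ≢ x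

-- Elimination tree of a connected linear graph ℍ, restricted to a vertex
-- set S (inducing a connected subgraph).  ETAnc ℍ S u v means: u is an
-- ancestor of or equal to v in ET(ℍ[S]).  The root is min S; its children
-- are the roots of ET(ℍ[K]) for the components K of ℍ[S] - min S.

data ETAnc {n : ℕ} (ℍ : Tog n) : Subset n → Fin n → Fin n → Set₁ where
  root : ∀ {S x v} → IsMinIn (le ℍ) S x → S v → ETAnc ℍ S x v
  sub  : ∀ {S x K u v} → IsMinIn (le ℍ) S x → IsComponent (adj ℍ) (S ∖ x) K
       → ETAnc ℍ K u v → ETAnc ℍ S u v

IsRelOf : ∀ {n} → Tog n → Tog n → Set₁
IsRelOf 𝐇 ℍ =
  IsLinear ℍ × Connected ℍ × (∀ u v → adj 𝐇 u v ≡ adj ℍ u v)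
  × (∀ u v → (T (le 𝐇 u v) → ETAnc ℍ (λ _ → ⊤) u v) × (ETAnc ℍ (λ _ → ⊤) u v → T (le 𝐇 u v)))

_≺_within_ : ∀ {n} → Fin n → Fin n → Tog n → Set
x ≺ y within G = T (le G x y) × x ≢ y

IsOrdered : ∀ {n} → Tog n → List (Fin n) → Set
IsOrdered G xs = AllPairs (λ x y → x ≺ y within G) xs

IsLast : ∀ {n} → List (Fin n) → Fin n → Set
IsLast xs m = ∃[ ys ] xs ≡ ys ∷ʳ m

StemCandidate : ∀ {n} → Tog n → List (Fin n) → Set
StemCandidate G xs =
  IsOrdered G xs × (∀ m → IsLast xs m → ∀ u → u ∉ xs → T (le G m u))

IsStem : ∀ {n} → Tog n → List (Fin n) → Set
IsStem G xs = StemCandidate G xs × (∀ ys → StemCandidate G ys → length ys ≤ length xs)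

IsStemPrefix : ∀ {n} → Tog n → List (Fin n) → Set
IsStemPrefix G xs = ∃[ zs ] IsStem G (xs ++ zs)

allMaps : ∀ n m → List (Fin n → Fin m)
allMaps zero    m = (λ ()) ∷ []
allMaps (suc n) m =
  concatMap (λ i → map (λ f → λ { Fin.zero → i ; (Fin.suc k) → f k }) (allMaps n m)) (allFin m)

_=ᶠ_ : ∀ {n} → Fin n → Fin n → Bool
a =ᶠ b = ⌊ a ≟ b ⌋

_=ᵇ_ : Bool → Bool → Bool
a =ᵇ b = ⌊ a ≟ᵇ b ⌋

_⇒ᵇ_ : Bool → Bool → Bool
a ⇒ᵇ b = not a ∨ b

-- φ(xᵢ) = yᵢ for all i (false if lengths differ)
pinned : ∀ {n m} → (Fin n → Fin m) → List (Fin n) → List (Fin m) → Bool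
pinned φ []       []       = true
pinned φ (x ∷ xs) (y ∷ ys) = (φ x =ᶠ y) ∧ pinned φ xs ys
pinned φ _        _        = false

allB : ∀ {A : Set} → (A → Bool) → List A → Bool
allB p []       = true
allB p (a ∷ as) = p a ∧ allB p as

isEmbedding : ∀ {n m} → Tog n → Tog m → (Fin n → Fin m) → Bool
isEmbedding {n} 𝐇 𝐆 φ =
  allB (λ u → allB (λ v →
       ((φ u =ᶠ φ v) ⇒ᵇ (u =ᶠ v))
     ∧ (adj 𝐇 u v =ᵇ adj 𝐆 (φ u) (φ v))
     ∧ (le 𝐇 u v ⇒ᵇ le 𝐆 (φ u) (φ v))) (allFin n)) (allFin n)

countTrue : ∀ {A : Set} → (A → Bool) → List A → ℕ
countTrue p []       = 0
countTrue p (a ∷ as) with p a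
... | true  = suc (countTrue p as)
... | false = countTrue p as

#[_↦_] : ∀ {n m} → List (Fin n) → List (Fin m) → Tog n → Tog m → ℕ
#[_↦_] {n} {m} xs ys 𝐇 𝐆 =
  countTrue (λ φ → isEmbedding 𝐇 𝐆 φ ∧ pinned φ xs ys) (allMaps n m)

module Submission where

-- Let 𝐇 = rel(ℍ).  Both sides of lemma5 count the maps φ : V(𝐇) → V(𝐇)
-- that fix x̄ and pass a Boolean embedding test; the two tests differ only
-- in the order that φ must preserve (the tree order of 𝐇 versus the
-- linear order of ℍ).  We show that these tests agree on every φ, so the
-- counts agree.
--
-- Since the tree order of 𝐇 refines into the order of ℍ, an embedding into
-- 𝐇 is one into ℍ.  Conversely let φ embed 𝐇 into ℍ and u ≼ v in 𝐇.  In the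
-- elimination tree, v is reached from u by a path through descendants of u
-- (descendant-path); φ maps it to a path from φ(u) to φ(v) that stays
-- ℍ-above φ(u), hence never visits a strict 𝐇-ancestor of φ(u).  The
-- climbing lemma says such a path in a tog, started at φ(u), ends at an
-- 𝐇-descendant of φ(u): φ(u) ≼ φ(v) in 𝐇.

open import Defs
open import Data.Nat using (ℕ; suc)
open import Data.Fin using (Fin)
open import Data.Bool using (Bool; true; false; T; _∧_)
open import Data.Bool.Properties using (T-∧; T-≡; ⇔→≡)
open import Data.List using (List; []; _∷_; allFin)
open import Data.List.Membership.Propositional using (_∈_)
open import Data.List.Membership.Propositional.Properties using (∈-allFin)
open import Data.List.Relation.Unary.Any using (here; there)
open import Data.Product using (_×_; _,_; proj₁; proj₂)
open import Data.Sum using (inj₁; inj₂)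
open import Data.Unit using (⊤; tt)
open import Function using (_⇔_; mk⇔; Equivalence)
open import Function.Construct.Composition using (_⇔-∘_)
open import Function.Construct.Symmetry using (⇔-sym)
open import Relation.Nullary.Decidable using (toWitness; fromWitness)
open import Relation.Binary.PropositionalEquality using (_≡_; refl; sym; trans; cong; subst)

open Equivalence using (to; from)

T-ext : ∀ {a b} → T a ⇔ T b → a ≡ b
T-ext a⇔b = ⇔→≡ {z = true} (T-≡ ⇔-∘ (a⇔b ⇔-∘ ⇔-sym T-≡))

T-⇒ᵇ : ∀ {a b} → T (a ⇒ᵇ b) ⇔ (T a → T b)
T-⇒ᵇ {false} = mk⇔ (λ _ ()) (λ _ → tt)
T-⇒ᵇ {true}  = mk⇔ (λ t _ → t) (λ f → f tt)

T-=ᶠ : ∀ {n} {i j : Fin n} → T (i =ᶠ j) ⇔ (i ≡ j)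
T-=ᶠ = mk⇔ toWitness fromWitness

T-=ᵇ : ∀ {a b} → T (a =ᵇ b) ⇔ (a ≡ b)
T-=ᵇ = mk⇔ toWitness fromWitness

T-allB : ∀ {A : Set} (p : A → Bool) (xs : List A) → T (allB p xs) ⇔ (∀ {a} → a ∈ xs → T (p a))
T-allB p []       = mk⇔ (λ _ ()) (λ _ → tt)
T-allB p (x ∷ xs) = mk⇔ forward backward
  where
  forward : T (allB p (x ∷ xs)) → ∀ {a} → a ∈ x ∷ xs → T (p a)
  forward t (here refl) = proj₁ (to T-∧ t)
  forward t (there a∈)  = to (T-allB p xs) (proj₂ (to T-∧ t)) a∈
  backward : (∀ {a} → a ∈ x ∷ xs → T (p a)) → T (allB p (x ∷ xs))
  backward f = from T-∧ (f (here refl) , from (T-allB p xs) (λ a∈ → f (there a∈)))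

T-allB-allFin : ∀ {n} (p : Fin n → Bool) → T (allB p (allFin n)) ⇔ (∀ i → T (p i))
T-allB-allFin {n} p = mk⇔
  (λ t i → to (T-allB p (allFin n)) t (∈-allFin i))
  (λ f → from (T-allB p (allFin n)) (λ {i} _ → f i))

countTrue-cong : ∀ {A : Set} {p q : A → Bool} → (∀ a → p a ≡ q a) → ∀ xs → countTrue p xs ≡ countTrue q xs
countTrue-cong p≗q [] = refl
countTrue-cong {p = p} {q} p≗q (a ∷ as) with p a | q a | p≗q a
... | true  | true  | refl = cong suc (countTrue-cong p≗q as)
... | false | false | refl = countTrue-cong p≗q as

EmbeddingAt : ∀ {n m} → Tog n → Tog m → (Fin n → Fin m) → Fin n → Fin n → Set
EmbeddingAt 𝐇 𝐆 φ u v =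
  (φ u ≡ φ v → u ≡ v) × adj 𝐇 u v ≡ adj 𝐆 (φ u) (φ v) × (T (le 𝐇 u v) → T (le 𝐆 (φ u) (φ v)))

IsEmbedding : ∀ {n m} → Tog n → Tog m → (Fin n → Fin m) → Set
IsEmbedding 𝐇 𝐆 φ = ∀ u v → EmbeddingAt 𝐇 𝐆 φ u v

T-isEmbedding : ∀ {n m} (𝐇 : Tog n) (𝐆 : Tog m) (φ : Fin n → Fin m)
              → T (isEmbedding 𝐇 𝐆 φ) ⇔ IsEmbedding 𝐇 𝐆 φ
T-isEmbedding {n} 𝐇 𝐆 φ = mk⇔
  (λ t u v → to (T-test u v) (to (T-allB-allFin (test u)) (to (T-allB-allFin _) t u) v))
  (λ e → from (T-allB-allFin _) λ u → from (T-allB-allFin (test u)) λ v → from (T-test u v) (e u v))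
  where
  injective? adjacency? order? test : Fin n → Fin n → Bool
  injective? u v = (φ u =ᶠ φ v) ⇒ᵇ (u =ᶠ v)
  adjacency? u v = adj 𝐇 u v =ᵇ adj 𝐆 (φ u) (φ v)
  order?     u v = le 𝐇 u v ⇒ᵇ le 𝐆 (φ u) (φ v)
  test u v = injective? u v ∧ adjacency? u v ∧ order? u v

  T-test : ∀ u v → T (test u v) ⇔ EmbeddingAt 𝐇 𝐆 φ u v
  T-test u v = mk⇔
    (λ t → let (i , a , o) = split t in
      (λ e → to T-=ᶠ (to T-⇒ᵇ i (from T-=ᶠ e))) , to T-=ᵇ a , to T-⇒ᵇ o)
    (λ (i , a , o) → from T-∧ (from T-⇒ᵇ (λ e → from T-=ᶠ (i (to T-=ᶠ e)))
                   , from T-∧ (from T-=ᵇ a , from T-⇒ᵇ o)))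
    where
    split : T (test u v) → T (injective? u v) × T (adjacency? u v) × T (order? u v)
    split t = let (i , r) = to T-∧ t in i , to T-∧ r

pathStart : ∀ {n} {E : Fin n → Fin n → Bool} {S : Subset n} {a b} → PathIn E S a b → S a
pathStart (stop s)     = s
pathStart (step s _ _) = s

mapPath : ∀ {n} {E E' : Fin n → Fin n → Bool} {S S' : Subset n} (g : Fin n → Fin n)
        → (∀ w → S w → S' (g w)) → (∀ a b → T (E a b) → T (E' (g a) (g b)))
        → ∀ {a b} → PathIn E S a b → PathIn E' S' (g a) (g b)
mapPath g inS onE (stop s)     = stop (inS _ s)
mapPath g inS onE (step s e p) = step (inS _ s) (onE _ _ e) (mapPath g inS onE p)

module _ {n : ℕ} (ℍ : Tog n) where

  -- The elimination tree is built by removing minima, so ancestors are ℍ-smaller.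
  ancestor⇒≤ : ∀ {S u v} → ETAnc ℍ S u v → T (le ℍ u v)
  ancestor⇒≤ (root (_ , min) sv) = min _ sv
  ancestor⇒≤ (sub _ _ anc)       = ancestor⇒≤ anc

  subtree-path : ∀ {S u v} (Q : Subset n) → (∀ w → ETAnc ℍ S u w → Q w)
               → ConnectedIn (adj ℍ) S → ETAnc ℍ S u v → PathIn (adj ℍ) Q u v
  subtree-path Q subtree⊆Q S-connected (root min sv) =
    mapPath (λ w → w) (λ w sw → subtree⊆Q w (root min sw)) (λ _ _ e → e)
            (S-connected _ _ (proj₁ min) sv)
  subtree-path Q subtree⊆Q _ (sub min K@(_ , _ , K-connected , _) anc) =
    subtree-path Q (λ w anc' → subtree⊆Q w (sub min K anc')) K-connected anc

-- Climbing lemma: in a tog 𝐆, a path that starts at a descendant of r and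
-- never visits a strict ancestor of r ends at a descendant of r.  (An edge
-- leaving the descendants of r would go down to a vertex comparable with r,
-- which is then r itself or a strict ancestor of r.)
climb : ∀ {n} (𝐆 : Tog n) {r a c} → T (le 𝐆 r a)
      → PathIn (adj 𝐆) (λ w → T (le 𝐆 w r) → w ≡ r) a c → T (le 𝐆 r c)
climb 𝐆 r≤a (stop _) = r≤a
climb 𝐆 {r} {a} r≤a (step {b = b} _ ab p) with edgeComparable 𝐆 a b ab
... | inj₁ a≤b = climb 𝐆 (IsTreeOrder.trans (isTreeOrder 𝐆) r a b r≤a a≤b) p
... | inj₂ b≤a with IsTreeOrder.downTotal (isTreeOrder 𝐆) a r b r≤a b≤a
...   | inj₁ r≤b = climb 𝐆 r≤b p
...   | inj₂ b≤r = climb 𝐆 r≤b p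
  where
  r≤b : T (le 𝐆 r b)
  r≤b = subst (λ z → T (le 𝐆 r z)) (sym (pathStart p b≤r)) (IsTreeOrder.reflexive (isTreeOrder 𝐆) r)

module RelOf {n : ℕ} (𝐇 ℍ : Tog n)
  (ℍ-connected : Connected ℍ)
  (same-adj : ∀ u v → adj 𝐇 u v ≡ adj ℍ u v)
  (le⇔anc : ∀ u v → (T (le 𝐇 u v) → ETAnc ℍ (λ _ → ⊤) u v) × (ETAnc ℍ (λ _ → ⊤) u v → T (le 𝐇 u v)))
  where

  ≤𝐇⇒≤ℍ : ∀ {u v} → T (le 𝐇 u v) → T (le ℍ u v)
  ≤𝐇⇒≤ℍ {u} {v} u≤v = ancestor⇒≤ ℍ (proj₁ (le⇔anc u v) u≤v)

  descendant-path : ∀ {u v} → T (le 𝐇 u v) → PathIn (adj 𝐇) (λ w → T (le 𝐇 u w)) u v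
  descendant-path {u} {v} u≤v =
    mapPath (λ w → w) (λ _ u≤w → u≤w) (λ a b e → subst T (sym (same-adj a b)) e)
      (subtree-path ℍ (λ w → T (le 𝐇 u w)) (λ w anc → proj₂ (le⇔anc u w) anc)
                    ℍ-connected (proj₁ (le⇔anc u v) u≤v))

  -- A map embedding 𝐇 into ℍ also preserves the tree order of 𝐇: the image
  -- of a descendant path of u stays ℍ-above φ(u), so the climbing lemma applies.
  reflect-order : (φ : Fin n → Fin n) → IsEmbedding 𝐇 ℍ φ
                → ∀ {u v} → T (le 𝐇 u v) → T (le 𝐇 (φ u) (φ v))
  reflect-order φ emb {u} u≤v =
    climb 𝐇 (IsTreeOrder.reflexive (isTreeOrder 𝐇) (φ u))
      (mapPath φ no-strict-ancestor edge (descendant-path u≤v))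
    where
    edge : ∀ a b → T (adj 𝐇 a b) → T (adj 𝐇 (φ a) (φ b))
    edge a b e = subst T (trans (proj₁ (proj₂ (emb a b))) (sym (same-adj (φ a) (φ b)))) e
    no-strict-ancestor : ∀ w → T (le 𝐇 u w) → T (le 𝐇 (φ w) (φ u)) → φ w ≡ φ u
    no-strict-ancestor w u≤w φw≤φu = IsTreeOrder.antisym (isTreeOrder ℍ) (φ w) (φ u)
      (≤𝐇⇒≤ℍ φw≤φu) (proj₂ (proj₂ (emb u w)) u≤w)

  embedding-transfer : (φ : Fin n → Fin n) → IsEmbedding 𝐇 𝐇 φ ⇔ IsEmbedding 𝐇 ℍ φ
  embedding-transfer φ = mk⇔ into-ℍ into-𝐇
    where
    into-ℍ : IsEmbedding 𝐇 𝐇 φ → IsEmbedding 𝐇 ℍ φ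
    into-ℍ emb u v = let (inj , adj≡ , mono) = emb u v in
      inj , trans adj≡ (same-adj (φ u) (φ v)) , (λ u≤v → ≤𝐇⇒≤ℍ (mono u≤v))
    into-𝐇 : IsEmbedding 𝐇 ℍ φ → IsEmbedding 𝐇 𝐇 φ
    into-𝐇 emb u v = let (inj , adj≡ , _) = emb u v in
      inj , trans adj≡ (sym (same-adj (φ u) (φ v))) , reflect-order φ emb

  isEmbedding-rel : (φ : Fin n → Fin n) → isEmbedding 𝐇 𝐇 φ ≡ isEmbedding 𝐇 ℍ φ
  isEmbedding-rel φ =
    T-ext (⇔-sym (T-isEmbedding 𝐇 ℍ φ) ⇔-∘ (embedding-transfer φ ⇔-∘ T-isEmbedding 𝐇 𝐇 φ))

lemma5 : ∀ {n : ℕ} (𝐇 ℍ : Tog n) (xs : List (Fin n))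
       → IsRelOf 𝐇 ℍ → Connected 𝐇 → IsStemPrefix 𝐇 xs
       → #[ xs ↦ xs ] 𝐇 𝐇 ≡ #[ xs ↦ xs ] 𝐇 ℍ
lemma5 {n} 𝐇 ℍ xs (_ , ℍ-connected , same-adj , le⇔anc) _ _ =
  countTrue-cong (λ φ → cong (_∧ pinned φ xs xs) (isEmbedding-rel φ)) (allMaps n n)
  where open RelOf 𝐇 ℍ ℍ-connected same-adj le⇔anc
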